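{- Let $w\in\mathfrak{H}_n$ and suppose there are integers $r\ge1$, $i_1\ge0$ and $i_2,\dots,i_r\ge1$ with $i_1+\dots+i_r=n$ such that the right part $w(1),w(2),\dots,w(n)$ of $w$ is the concatenation of the increasing runs \[-(i_1+i_2),\dots,-(i_1+1);\quad -(i_1+i_2+i_3),\dots,-(i_1+i_2+1);\quad\dots;\quad -(i_1+\cdots+i_r),\dots,-(i_1+\cdots+i_{r-1}+1);\quad 1,2,\dots,i_1,\] (each run listed in increasing order of values). Then the $\vec c$-sorting word of $w$ is the concatenation $R_r R_{r-1}\cdots R_2$, where $R_m=s_{n-i_m\dots0}\,s_{n-i_m+1\dots0}\cdots s_{n-1\dots0}$ (a product of $i_m$ factors), and $s_{k\dots0}=s_ks_{k-1}\cdots s_1s_0$.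
   Context: $\mathfrak{H}_n$: permutations $\pi$ of $\pm[n]=\{ -n,\dots,-1,1,\dots,n\}$ with $\pi(-a)=-\pi(a)$, product = composition $(\pi\sigma)(a)=\pi(\sigma(a))$; Coxeter group of type $B_n$ with simple generators $s_0$ (exchanging $1,-1$) and $s_i$ (exchanging $i,i+1$ and $-i,-i-1$), $1\le i\le n-1$. $\vec c=s_0s_1\cdots s_{n-1}$; the $\vec c$-sorting word of $w\in\mathfrak{H}_n$ is the reduced word for $w$ that appears as far to the right as possible as a subword of the left-infinite word $\cdots s_{n-1}\cdots s_1s_0\,s_{n-1}\cdots s_1s_0$ consisting of infinitely many copies of $s_{n-1}\cdots s_1s_0$. -}

module Defs where

open import Data.Nat using (ℕ; zero; suc; _+_; _∸_; _≤_; _<_; _≡ᵇ_)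
open import Data.Integer as ℤ using (ℤ; +_; -_)
open import Data.Bool using (if_then_else_)
open import Data.Fin using (Fin; toℕ)
open import Data.List using (List; []; _∷_; _++_; map; reverse; upTo; downFrom; concatMap; length; foldl)
open import Data.List.Relation.Unary.Linked using (Linked)
open import Data.Product using (Σ; _×_; _,_; proj₂)
open import Data.Sum using (_⊎_)
open import Data.Unit using (⊤)
open import Data.Empty using (⊥)
open import Relation.Binary.PropositionalEquality using (_≡_)

-- An element π of the hyperoctahedral group 𝔥_n is recorded by its right part
-- (window) j ↦ π(j) for j = 1..n (values at other arguments are irrelevant);
-- it determines π via π(-a) = -π(a).
Window : Set
Window = ℕ → ℤ

_≈[_]_ : Window → ℕ → Window → Set
f ≈[ n ] g = ∀ j → 1 ≤ j → j ≤ n → f j ≡ g j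

idW : Window
idW j = + j

-- right multiplication by s_k: (π s_k)(j) = π(s_k(j)).
-- s_0 exchanges 1 and -1; s_k (k ≥ 1) exchanges k and k+1 (and -k, -k-1).
rmul : ℕ → Window → Window
rmul zero f j = if j ≡ᵇ 1 then - f 1 else f j
rmul (suc k) f j =
  if j ≡ᵇ suc k then f (suc (suc k)) else (if j ≡ᵇ suc (suc k) then f (suc k) else f j)

Word : ℕ → Set
Word n = List (Fin n)

eval : ∀ {n} → Word n → Window
eval W = foldl (λ f k → rmul (toℕ k) f) idW W

IsReducedWordFor : (n : ℕ) → Window → Word n → Set
IsReducedWordFor n w W =
  (eval W ≈[ n ] w) × (∀ (V : Word n) → eval V ≈[ n ] w → length W ≤ length V)

-- Positions in the left-infinite word ⋯ (s_{n-1}⋯s_1 s_0)(s_{n-1}⋯s_1 s_0),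
-- counted from the right: (b , k) is the letter s_k in the b-th copy from the
-- right (b = 0 is the rightmost copy).
Pos : ℕ → Set
Pos n = ℕ × Fin n

-- p <P q : p lies strictly to the right of q
_<P_ : ∀ {n} → Pos n → Pos n → Set
(b , k) <P (c , l) = (b < c) ⊎ ((b ≡ c) × (toℕ k < toℕ l))

-- a subword is given by a list of positions listed from right to left
-- (strictly increasing in <P); the word it spells, read left to right:
spell : ∀ {n} → List (Pos n) → Word n
spell P = reverse (map proj₂ P)

-- lexicographic comparison of position lists (from the right end):
-- P ≤Lex Q means P is at least as far to the right as Q
_≤Lex_ : ∀ {n} → List (Pos n) → List (Pos n) → Set
[] ≤Lex [] = ⊤
(p ∷ P) ≤Lex (q ∷ Q) = (p <P q) ⊎ ((p ≡ q) × (P ≤Lex Q))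
[] ≤Lex (_ ∷ _) = ⊥
(_ ∷ _) ≤Lex [] = ⊥

-- W is the c-sorting word of w (c = s_0 s_1 ⋯ s_{n-1}): a reduced word for w
-- occurring as a subword of the left-infinite word as far right as possible.
IsSortingWord : (n : ℕ) → Window → Word n → Set
IsSortingWord n w W =
  IsReducedWordFor n w W ×
  Σ (List (Pos n)) λ P → Linked _<P_ P × (spell P ≡ W) ×
    (∀ (Q : List (Pos n)) → Linked _<P_ Q → IsReducedWordFor n w (spell Q) → P ≤Lex Q)

run : ℕ → ℕ → List ℤ
run S i = map (λ k → - (+ (S + i ∸ k))) (upTo i)

runs : ℕ → List ℕ → List ℤ
runs S [] = []
runs S (i ∷ is) = run S i ++ runs (S + i) is

targetWindow : ℕ → List ℕ → List ℤ
targetWindow i₁ rest = runs i₁ rest ++ map (λ k → + suc k) (upTo i₁)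

sDown : ℕ → List ℕ
sDown k = downFrom (suc k)

Rblock : ℕ → ℕ → List ℕ
Rblock n i = concatMap (λ j → sDown (n ∸ i + j)) (upTo i)

-- R_r R_{r-1} ⋯ R_2, where rest = i_2,…,i_r
claimedWord : ℕ → List ℕ → List ℕ
claimedWord n rest = concatMap (Rblock n) (reverse rest)

sumL : List ℕ → ℕ
sumL [] = 0
sumL (x ∷ xs) = x + sumL xs

{-# OPTIONS --safe #-}

-- Each generator changes the type-B inversion statistic ℓ by at most one, so ℓ(w) bounds the
-- length of every word for w.  Apply the factors s_{k…0} of the claimed word to the identity one at a
-- time: the right part always consists of some negative entries followed by an increasing run of
-- positive ones, and since k is at least the number of negative entries, s_{k…0} moves the
-- (k+1)-st entry to the front with its sign changed and raises ℓ by exactly k + 1.  Hence the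
-- claimed word has length ℓ(w) and is reduced.  In the left-infinite word its factors occupy the
-- letters s_0, …, s_k of consecutive copies of s_{n-1}⋯s_0, and every letter s_l, l > k, skipped
-- in between is an ascent of what remains to be sorted, because the positive entries increase.
-- Another reduced subword, compared from the right, can first differ from the claimed one only by
-- lying further left: taking a skipped ascent instead would leave too many letters to undo.

module Submission where

open import Defs
open import Data.Nat using (ℕ; zero; suc; _+_; _∸_; _≤_; _<_; z≤n; s≤s; s≤s⁻¹)
import Data.Nat.Properties as ℕ
open import Data.Nat.ListAction using (sum)
open import Data.Nat.Solver using (module +-*-Solver)
open import Algebra.Properties.CommutativeSemigroup ℕ.+-commutativeSemigroup using (x∙yz≈y∙xz)
open import Data.Integer using (ℤ; -_; 0ℤ)
import Data.Integer as ℤ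
import Data.Integer.Properties as ℤ
open import Data.Fin using (toℕ; fromℕ<)
import Data.Fin.Properties as Fin
open import Data.List
  using (List; []; _∷_; _++_; [_]; map; reverse; foldl; foldr; length; applyUpTo; upTo; concatMap)
import Data.List.Properties as List
open import Data.List.Reverse using (Reverse; reverseView; []; _∶_∶ʳ_)
open import Data.List.Relation.Unary.All using (All; []; _∷_)
import Data.List.Relation.Unary.All as All
import Data.List.Relation.Unary.All.Properties as All
open import Data.List.Relation.Unary.Linked using (Linked; []; [-]; _∷_)
import Data.List.Relation.Unary.Linked as Linked
import Data.List.Relation.Unary.Linked.Properties as Linked
open import Data.Product using (Σ; _×_; _,_; proj₁; proj₂)
open import Data.Sum using (_⊎_; inj₁; inj₂)
open import Data.Unit using (⊤; tt)
open import Data.Empty using (⊥; ⊥-elim)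
open import Function using (_∘_)
open import Relation.Nullary using (Dec; yes; no; ¬_)
open import Relation.Binary.Definitions using (tri<; tri≈; tri>)
open import Relation.Binary.PropositionalEquality hiding ([_])

ind : ∀ {p} {P : Set p} → Dec P → ℕ
ind (yes _) = 1
ind (no _)  = 0

ind≤1 : ∀ {p} {P : Set p} (d : Dec P) → ind d ≤ 1
ind≤1 (yes _) = s≤s z≤n
ind≤1 (no _)  = z≤n

ind-yes : ∀ {p} {P : Set p} (d : Dec P) → P → ind d ≡ 1
ind-yes (yes _) _ = refl
ind-yes (no ¬p) p = ⊥-elim (¬p p)

ind-no : ∀ {p} {P : Set p} (d : Dec P) → ¬ P → ind d ≡ 0
ind-no (yes p) ¬p = ⊥-elim (¬p p)
ind-no (no _)  _  = refl

ind-cong : ∀ {p q} {P : Set p} {Q : Set q} (d : Dec P) (e : Dec Q) → (P → Q) → (Q → P) → ind d ≡ ind e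
ind-cong (yes _) (yes _) _ _ = refl
ind-cong (yes p) (no ¬q) f _ = ⊥-elim (¬q (f p))
ind-cong (no ¬p) (yes q) _ g = ⊥-elim (¬p (g q))
ind-cong (no _)  (no _)  _ _ = refl

<-neg⇒+<0 : ∀ c {x} → x ℤ.< - c → c ℤ.+ x ℤ.< 0ℤ
<-neg⇒+<0 c {x} x<-c = subst (c ℤ.+ x ℤ.<_) (ℤ.+-inverseʳ c) (ℤ.+-monoʳ-< c x<-c)

+<0⇒<-neg : ∀ c {x} → c ℤ.+ x ℤ.< 0ℤ → x ℤ.< - c
+<0⇒<-neg c {x} c+x<0 = subst₂ ℤ._<_ cancel (ℤ.+-identityʳ (- c)) (ℤ.+-monoʳ-< (- c) c+x<0)
  where
  open ≡-Reasoning
  cancel : - c ℤ.+ (c ℤ.+ x) ≡ x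
  cancel = begin
    - c ℤ.+ (c ℤ.+ x) ≡⟨ ℤ.+-assoc (- c) c x ⟨
    (- c ℤ.+ c) ℤ.+ x ≡⟨ cong (ℤ._+ x) (ℤ.+-inverseˡ c) ⟩
    0ℤ ℤ.+ x          ≡⟨ ℤ.+-identityˡ x ⟩
    x                 ∎

act : ℕ → List ℤ → List ℤ
act zero          []           = []
act zero          (x ∷ xs)     = - x ∷ xs
act (suc zero)    []           = []
act (suc zero)    (x ∷ [])     = x ∷ []
act (suc zero)    (x ∷ y ∷ xs) = y ∷ x ∷ xs
act (suc (suc k)) []           = []
act (suc (suc k)) (x ∷ xs)     = x ∷ act (suc k) xs

actWord : List ℤ → List ℕ → List ℤ
actWord = foldl (λ x k → act k x)

act-involutive : ∀ k xs → act k (act k xs) ≡ xs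
act-involutive zero          []           = refl
act-involutive zero          (x ∷ xs)     = cong (_∷ xs) (ℤ.neg-involutive x)
act-involutive (suc zero)    []           = refl
act-involutive (suc zero)    (x ∷ [])     = refl
act-involutive (suc zero)    (x ∷ y ∷ xs) = refl
act-involutive (suc (suc k)) []           = refl
act-involutive (suc (suc k)) (x ∷ xs)     = cong (x ∷_) (act-involutive (suc k) xs)

length-act : ∀ k xs → length (act k xs) ≡ length xs
length-act zero          []           = refl
length-act zero          (x ∷ xs)     = refl
length-act (suc zero)    []           = refl
length-act (suc zero)    (x ∷ [])     = refl
length-act (suc zero)    (x ∷ y ∷ xs) = refl
length-act (suc (suc k)) []           = refl
length-act (suc (suc k)) (x ∷ xs)     = cong suc (length-act (suc k) xs)

act-++ : ∀ A a b C → act (suc (length A)) (A ++ a ∷ b ∷ C) ≡ A ++ b ∷ a ∷ C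
act-++ []      a b C = refl
act-++ (x ∷ A) a b C = cong (x ∷_) (act-++ A a b C)

actWord-++ : ∀ x A B → actWord x (A ++ B) ≡ actWord (actWord x A) B
actWord-++ = List.foldl-++ (λ x k → act k x)

actWord-∷ʳ : ∀ x A k → actWord x (A ++ [ k ]) ≡ act k (actWord x A)
actWord-∷ʳ x A k = actWord-++ x A [ k ]

actWord-reverse : ∀ V x → actWord (actWord x V) (reverse V) ≡ x
actWord-reverse []      x = refl
actWord-reverse (k ∷ V) x = begin
  actWord (actWord (act k x) V) (reverse (k ∷ V))    ≡⟨ cong (actWord _) (List.unfold-reverse k V) ⟩
  actWord (actWord (act k x) V) (reverse V ++ [ k ]) ≡⟨ actWord-∷ʳ _ (reverse V) k ⟩
  act k (actWord (actWord (act k x) V) (reverse V))  ≡⟨ cong (act k) (actWord-reverse V (act k x)) ⟩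
  act k (act k x)                                    ≡⟨ act-involutive k x ⟩
  x                                                  ∎
  where open ≡-Reasoning

length-actWord : ∀ V x → length (actWord x V) ≡ length x
length-actWord []      x = refl
length-actWord (k ∷ V) x = trans (length-actWord V (act k x)) (length-act k x)

⟦_<_⟧ : ℤ → ℤ → ℕ
⟦ x < y ⟧ = ind (x ℤ.<? y)

pairInversions : ℤ → ℤ → ℕ
pairInversions x y = ⟦ y < x ⟧ + ⟦ x ℤ.+ y < 0ℤ ⟧

inversionsWith : ℤ → List ℤ → ℕ
inversionsWith x ys = sum (map (pairInversions x) ys)

-- The length function of type B:
-- ℓ(w) = #{i : w(i) < 0} + #{i < j : w(i) > w(j)} + #{i < j : w(i) + w(j) < 0}.
ℓ : List ℤ → ℕ
ℓ []       = 0
ℓ (x ∷ xs) = ⟦ x < 0ℤ ⟧ + inversionsWith x xs + ℓ xs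

pairInversions-neg : ∀ b y → pairInversions (- b) y ≡ pairInversions b y
pairInversions-neg b y = trans (cong₂ _+_ y<-b b-y<0) (ℕ.+-comm ⟦ b ℤ.+ y < 0ℤ ⟧ ⟦ y < b ⟧)
  where
  y<-b : ⟦ y < - b ⟧ ≡ ⟦ b ℤ.+ y < 0ℤ ⟧
  y<-b = ind-cong (y ℤ.<? - b) (b ℤ.+ y ℤ.<? 0ℤ) (<-neg⇒+<0 b) (+<0⇒<-neg b)
  b-y<0 : ⟦ - b ℤ.+ y < 0ℤ ⟧ ≡ ⟦ y < b ⟧
  b-y<0 = ind-cong (- b ℤ.+ y ℤ.<? 0ℤ) (y ℤ.<? b)
    (λ p → subst (y ℤ.<_) (ℤ.neg-involutive b) (+<0⇒<-neg (- b) p))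
    (λ p → <-neg⇒+<0 (- b) (subst (y ℤ.<_) (sym (ℤ.neg-involutive b)) p))

inversionsWith-neg : ∀ b ys → inversionsWith (- b) ys ≡ inversionsWith b ys
inversionsWith-neg b []       = refl
inversionsWith-neg b (y ∷ ys) = cong₂ _+_ (pairInversions-neg b y) (inversionsWith-neg b ys)

inversionsWith-act : ∀ k z xs → inversionsWith z (act (suc k) xs) ≡ inversionsWith z xs
inversionsWith-act zero    z []           = refl
inversionsWith-act zero    z (x ∷ [])     = refl
inversionsWith-act zero    z (x ∷ y ∷ xs) = x∙yz≈y∙xz (pairInversions z y) (pairInversions z x) (inversionsWith z xs)
inversionsWith-act (suc k) z []           = refl
inversionsWith-act (suc k) z (x ∷ xs)     = cong (pairInversions z x +_) (inversionsWith-act k z xs)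

ℓ-swap-head : ∀ x y xs → ℓ (y ∷ x ∷ xs) + ⟦ y < x ⟧ ≡ ℓ (x ∷ y ∷ xs) + ⟦ x < y ⟧
ℓ-swap-head x y xs rewrite ℤ.+-comm y x =
  solve 8 (λ a b c d e f g h → (a :+ (b :+ c :+ d) :+ (e :+ f :+ g)) :+ h
                             := (e :+ (h :+ c :+ f) :+ (a :+ d :+ g)) :+ b)
    refl ⟦ y < 0ℤ ⟧ ⟦ x < y ⟧ ⟦ x ℤ.+ y < 0ℤ ⟧ (inversionsWith y xs)
         ⟦ x < 0ℤ ⟧ (inversionsWith x xs) (ℓ xs) ⟦ y < x ⟧
  where open +-*-Solver using (solve; _:+_; _:=_)

ℓ-act-≤ : ∀ k xs → ℓ (act k xs) ≤ suc (ℓ xs)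
ℓ-act-≤ zero [] = z≤n
ℓ-act-≤ zero (x ∷ xs) rewrite inversionsWith-neg x xs =
  ℕ.+-monoˡ-≤ (ℓ xs) (ℕ.+-monoˡ-≤ (inversionsWith x xs) (ℕ.≤-trans (ind≤1 (- x ℤ.<? 0ℤ)) (s≤s z≤n)))
ℓ-act-≤ (suc zero) [] = z≤n
ℓ-act-≤ (suc zero) (x ∷ []) = ℕ.n≤1+n _
ℓ-act-≤ (suc zero) (x ∷ y ∷ xs) = begin
  ℓ (y ∷ x ∷ xs)                    ≤⟨ ℕ.m≤m+n _ ⟦ y < x ⟧ ⟩
  ℓ (y ∷ x ∷ xs) + ⟦ y < x ⟧        ≡⟨ ℓ-swap-head x y xs ⟩
  ℓ (x ∷ y ∷ xs) + ⟦ x < y ⟧        ≤⟨ ℕ.+-monoʳ-≤ (ℓ (x ∷ y ∷ xs)) (ind≤1 (x ℤ.<? y)) ⟩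
  ℓ (x ∷ y ∷ xs) + 1                ≡⟨ ℕ.+-comm _ 1 ⟩
  suc (ℓ (x ∷ y ∷ xs))              ∎
  where open ℕ.≤-Reasoning
ℓ-act-≤ (suc (suc k)) [] = z≤n
ℓ-act-≤ (suc (suc k)) (x ∷ xs) rewrite inversionsWith-act k x xs =
  ℕ.≤-trans (ℕ.+-monoʳ-≤ (⟦ x < 0ℤ ⟧ + inversionsWith x xs) (ℓ-act-≤ (suc k) xs))
            (ℕ.≤-reflexive (ℕ.+-suc _ (ℓ xs)))

ℓ-actWord-≤ : ∀ V x → ℓ (actWord x V) ≤ length V + ℓ x
ℓ-actWord-≤ []      x = ℕ.≤-refl
ℓ-actWord-≤ (k ∷ V) x = ℕ.≤-trans (ℓ-actWord-≤ V (act k x))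
  (ℕ.≤-trans (ℕ.+-monoʳ-≤ (length V) (ℓ-act-≤ k x)) (ℕ.≤-reflexive (ℕ.+-suc (length V) (ℓ x))))

ℓ-act-ascent : ∀ {a b} → a ℤ.< b → ∀ A C → ℓ (A ++ b ∷ a ∷ C) ≡ suc (ℓ (A ++ a ∷ b ∷ C))
ℓ-act-ascent {a} {b} a<b [] C = begin
  ℓ (b ∷ a ∷ C)              ≡⟨ ℕ.+-identityʳ _ ⟨
  ℓ (b ∷ a ∷ C) + 0          ≡⟨ cong (ℓ (b ∷ a ∷ C) +_) (ind-no (b ℤ.<? a) (ℤ.<-asym a<b)) ⟨
  ℓ (b ∷ a ∷ C) + ⟦ b < a ⟧  ≡⟨ ℓ-swap-head a b C ⟩
  ℓ (a ∷ b ∷ C) + ⟦ a < b ⟧  ≡⟨ cong (ℓ (a ∷ b ∷ C) +_) (ind-yes (a ℤ.<? b) a<b) ⟩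
  ℓ (a ∷ b ∷ C) + 1          ≡⟨ ℕ.+-comm _ 1 ⟩
  suc (ℓ (a ∷ b ∷ C))        ∎
  where open ≡-Reasoning
ℓ-act-ascent {a} {b} a<b (z ∷ A) C = begin
  ⟦ z < 0ℤ ⟧ + inversionsWith z (A ++ b ∷ a ∷ C) + ℓ (A ++ b ∷ a ∷ C)
    ≡⟨ cong₂ (λ s t → ⟦ z < 0ℤ ⟧ + s + t) swapped (ℓ-act-ascent a<b A C) ⟩
  ⟦ z < 0ℤ ⟧ + inversionsWith z (A ++ a ∷ b ∷ C) + suc (ℓ (A ++ a ∷ b ∷ C))
    ≡⟨ ℕ.+-suc _ _ ⟩
  suc (ℓ (z ∷ A ++ a ∷ b ∷ C)) ∎
  where
  open ≡-Reasoning
  swapped : inversionsWith z (A ++ b ∷ a ∷ C) ≡ inversionsWith z (A ++ a ∷ b ∷ C)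
  swapped = trans (cong (inversionsWith z) (sym (act-++ A a b C))) (inversionsWith-act (length A) z _)

ℓ-neg : ∀ {b} → 0ℤ ℤ.< b → ∀ C → ℓ (- b ∷ C) ≡ suc (ℓ (b ∷ C))
ℓ-neg {b} 0<b C rewrite inversionsWith-neg b C
  | ind-yes (- b ℤ.<? 0ℤ) (ℤ.neg-mono-< 0<b)
  | ind-no (b ℤ.<? 0ℤ) (ℤ.<-asym 0<b) = refl

actDown : ℕ → List ℤ → List ℤ
actDown k x = actWord x (sDown k)

length-∷ʳ : ∀ {A : Set} (xs : List A) x → length (xs ++ [ x ]) ≡ suc (length xs)
length-∷ʳ xs x = trans (List.length-++ xs) (ℕ.+-comm (length xs) 1)

actDown-++ : ∀ A b C → actDown (length A) (A ++ b ∷ C) ≡ - b ∷ A ++ C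
actDown-++ A = go (reverseView A)
  where
  go : ∀ {A} → Reverse A → ∀ b C → actDown (length A) (A ++ b ∷ C) ≡ - b ∷ A ++ C
  go []           b C = refl
  go (A ∶ r ∶ʳ a) b C = begin
    actDown (length (A ++ [ a ])) ((A ++ [ a ]) ++ b ∷ C)
      ≡⟨ cong₂ actDown (length-∷ʳ A a) (List.∷ʳ-++ A a (b ∷ C)) ⟩
    actDown (length A) (act (suc (length A)) (A ++ a ∷ b ∷ C))
      ≡⟨ cong (actDown (length A)) (act-++ A a b C) ⟩
    actDown (length A) (A ++ b ∷ a ∷ C)
      ≡⟨ go r b (a ∷ C) ⟩
    - b ∷ A ++ a ∷ C
      ≡⟨ cong (- b ∷_) (List.∷ʳ-++ A a C) ⟨
    - b ∷ (A ++ [ a ]) ++ C ∎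
    where open ≡-Reasoning

-- Each of the |A| swaps moving b to the front passes an entry smaller than b,
-- and the final sign change of the positive b adds one more inversion.
ℓ-actDown-++ : ∀ {b} → 0ℤ ℤ.< b → ∀ A C → All (ℤ._< b) A →
  ℓ (actDown (length A) (A ++ b ∷ C)) ≡ length A + suc (ℓ (A ++ b ∷ C))
ℓ-actDown-++ {b} 0<b A = go (reverseView A)
  where
  go : ∀ {A} → Reverse A → ∀ C → All (ℤ._< b) A →
    ℓ (actDown (length A) (A ++ b ∷ C)) ≡ length A + suc (ℓ (A ++ b ∷ C))
  go []           C _     = ℓ-neg 0<b C
  go (A ∶ r ∶ʳ a) C A<b with All.∷ʳ⁻ A<b
  ... | A'<b , a<b = begin
    ℓ (actDown (length (A ++ [ a ])) ((A ++ [ a ]) ++ b ∷ C))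
      ≡⟨ cong ℓ (cong₂ actDown (length-∷ʳ A a) (List.∷ʳ-++ A a (b ∷ C))) ⟩
    ℓ (actDown (length A) (act (suc (length A)) (A ++ a ∷ b ∷ C)))
      ≡⟨ cong (ℓ ∘ actDown (length A)) (act-++ A a b C) ⟩
    ℓ (actDown (length A) (A ++ b ∷ a ∷ C))
      ≡⟨ go r (a ∷ C) A'<b ⟩
    length A + suc (ℓ (A ++ b ∷ a ∷ C))
      ≡⟨ cong (λ t → length A + suc t) (ℓ-act-ascent a<b A C) ⟩
    length A + suc (suc (ℓ (A ++ a ∷ b ∷ C)))
      ≡⟨ ℕ.+-suc (length A) _ ⟩
    suc (length A) + suc (ℓ (A ++ a ∷ b ∷ C))
      ≡⟨ cong₂ (λ s t → s + suc (ℓ t)) (length-∷ʳ A a) (List.∷ʳ-++ A a (b ∷ C)) ⟨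
    length (A ++ [ a ]) + suc (ℓ ((A ++ [ a ]) ++ b ∷ C)) ∎
    where open ≡-Reasoning

_<ℤ_ : ℤ → ℤ → Set
_<ℤ_ = ℤ._<_

data NegAsc : ℕ → List ℤ → Set where
  negAsc : ∀ {negs ys} → All (_<ℤ 0ℤ) negs → Linked _<ℤ_ ys → All (0ℤ <ℤ_) ys →
           NegAsc (length negs) (negs ++ ys)

Ascents : ℕ → List ℤ → Set
Ascents k y = ∀ l → k < l → l < length y → ℓ (act l y) ≡ suc (ℓ y)

split-at : ∀ {A : Set} i (xs : List A) → i < length xs →
  Σ (List A) λ B → Σ A λ b → Σ (List A) λ C → (xs ≡ B ++ b ∷ C) × (length B ≡ i)
split-at zero    (x ∷ xs) _       = [] , x , xs , refl , refl
split-at (suc i) (x ∷ xs) (s≤s p) with split-at i xs p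
... | B , b , C , refl , refl = x ∷ B , b , C , refl , refl

split-ascent-at : ∀ i xs → Linked _<ℤ_ xs → suc i < length xs →
  Σ (List ℤ) λ A → Σ ℤ λ a → Σ ℤ λ b → Σ (List ℤ) λ C →
    (xs ≡ A ++ a ∷ b ∷ C) × (length A ≡ i) × (a ℤ.< b)
split-ascent-at zero    (x ∷ y ∷ xs) (x<y ∷ _) _ = [] , x , y , xs , refl , refl , x<y
split-ascent-at zero    (x ∷ [])     [-]       (s≤s ())
split-ascent-at (suc i) (x ∷ xs) L (s≤s p) with split-ascent-at i xs (Linked.tail L) p
... | A , a , b , C , refl , refl , a<b = x ∷ A , a , b , C , refl , refl , a<b

linked⇒all : ∀ {x} xs → Linked _<ℤ_ (x ∷ xs) → All (x <ℤ_) xs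
linked⇒all []       _         = []
linked⇒all (y ∷ ys) (x<y ∷ L) = Linked.Linked⇒All ℤ.<-trans x<y L

linked-before : ∀ A {b} C → Linked _<ℤ_ (A ++ b ∷ C) → All (_<ℤ b) A
linked-before []      C L = []
linked-before (a ∷ A) C L =
  All.head (All.++⁻ʳ A (linked⇒all (A ++ _ ∷ C) L)) ∷ linked-before A C (Linked.tail L)

linked-delete : ∀ A {b} C → Linked _<ℤ_ (A ++ b ∷ C) → Linked _<ℤ_ (A ++ C)
linked-delete []           C           L                = Linked.tail L
linked-delete (a ∷ [])     []          L                = [-]
linked-delete (a ∷ [])     (c ∷ C)     (a<b ∷ b<c ∷ L)  = ℤ.<-trans a<b b<c ∷ L
linked-delete (a ∷ a' ∷ A) C           (a<a' ∷ L)       = a<a' ∷ linked-delete (a' ∷ A) C L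

offset-< : ∀ {X : Set} (P Q : List X) {k} → length P ≤ k → k < length (P ++ Q) → k ∸ length P < length Q
offset-< P Q {k} P≤k k< = subst (k ∸ length P <_) (trans (cong (_∸ length P) (List.length-++ P))
  (ℕ.m+n∸m≡n (length P) (length Q))) (ℕ.∸-monoˡ-< k< P≤k)

offset-≡ : ∀ {X : Set} (P A : List X) {k} → length P ≤ k → length A ≡ k ∸ length P → length (P ++ A) ≡ k
offset-≡ P A P≤k |A| = trans (List.length-++ P) (trans (cong (length P +_) |A|) (ℕ.m+[n∸m]≡n P≤k))

NegAsc⇒Ascents : ∀ {j y} → NegAsc j y → Ascents j y
NegAsc⇒Ascents (negAsc _ _ _) zero () _
NegAsc⇒Ascents (negAsc {negs} {ys} _ L _) (suc l) (s≤s j≤l) l<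
  with split-ascent-at (l ∸ length negs) ys L
         (subst (_< length ys) (ℕ.+-∸-assoc 1 j≤l) (offset-< negs ys (ℕ.m≤n⇒m≤1+n j≤l) l<))
... | A , a , b , C , refl , |A| , a<b = begin
  ℓ (act (suc l) (negs ++ A ++ a ∷ b ∷ C))
    ≡⟨ cong₂ (λ m t → ℓ (act (suc m) t)) (offset-≡ negs A j≤l |A|) (List.++-assoc negs A _) ⟨
  ℓ (act (suc (length (negs ++ A))) ((negs ++ A) ++ a ∷ b ∷ C))
    ≡⟨ cong ℓ (act-++ (negs ++ A) a b C) ⟩
  ℓ ((negs ++ A) ++ b ∷ a ∷ C)
    ≡⟨ ℓ-act-ascent a<b (negs ++ A) C ⟩
  suc (ℓ ((negs ++ A) ++ a ∷ b ∷ C))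
    ≡⟨ cong (suc ∘ ℓ) (List.++-assoc negs A _) ⟩
  suc (ℓ (negs ++ A ++ a ∷ b ∷ C)) ∎
  where open ≡-Reasoning

-- s_{k…0} with k ≥ j moves the (positive) entry in position k + 1 to the front with a minus sign.
actDown-NegAsc : ∀ {j k y} → NegAsc j y → j ≤ k → k < length y →
  NegAsc (suc j) (actDown k y) × (ℓ (actDown k y) ≡ k + suc (ℓ y))
actDown-NegAsc (negAsc {negs} {ys} neg L pos) j≤k k<
  with split-at (_ ∸ length negs) ys (offset-< negs ys j≤k k<)
... | A , b , C , refl , |A| rewrite sym (offset-≡ negs A j≤k |A|) | sym (List.++-assoc negs A (b ∷ C)) =
  subst (NegAsc _) (sym moved) (negAsc (ℤ.neg-mono-< 0<b ∷ neg) (linked-delete A C L) pos')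
  , ℓ-actDown-++ 0<b (negs ++ A) C
      (All.++⁺ (All.map (λ x<0 → ℤ.<-trans x<0 0<b) neg) (linked-before A C L))
  where
  pos' : All (0ℤ <ℤ_) (A ++ C)
  pos' = All.++⁺ (All.++⁻ˡ A pos) (All.tail (All.++⁻ʳ A pos))
  0<b : 0ℤ ℤ.< b
  0<b = All.head (All.++⁻ʳ A pos)
  moved : actDown (length (negs ++ A)) ((negs ++ A) ++ b ∷ C) ≡ - b ∷ negs ++ A ++ C
  moved = trans (actDown-++ (negs ++ A) b C) (cong (- b ∷_) (List.++-assoc negs A C))

-- Copies of Pos, _<P_, _≤Lex_ and spell from Defs with letters in ℕ; bounds on letters are kept separately.
Posℕ : Set
Posℕ = ℕ × ℕ

_<ₚ_ : Posℕ → Posℕ → Set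
(b , k) <ₚ (c , l) = (b < c) ⊎ ((b ≡ c) × (k < l))

_≤Lexℕ_ : List Posℕ → List Posℕ → Set
[]      ≤Lexℕ []      = ⊤
(p ∷ P) ≤Lexℕ (q ∷ Q) = (p <ₚ q) ⊎ ((p ≡ q) × (P ≤Lexℕ Q))
[]      ≤Lexℕ (_ ∷ _) = ⊥
(_ ∷ _) ≤Lexℕ []      = ⊥

spellℕ : List Posℕ → List ℕ
spellℕ P = reverse (map proj₂ P)

<ₚ-trichotomous : ∀ p q → (p <ₚ q) ⊎ (p ≡ q) ⊎ (q <ₚ p)
<ₚ-trichotomous (b , k) (c , l) with ℕ.<-cmp b c
... | tri< b<c _ _ = inj₁ (inj₁ b<c)
... | tri> _ _ c<b = inj₂ (inj₂ (inj₁ c<b))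
... | tri≈ _ refl _ with ℕ.<-cmp k l
...   | tri< k<l _ _  = inj₁ (inj₂ (refl , k<l))
...   | tri≈ _ refl _ = inj₂ (inj₁ refl)
...   | tri> _ _ l<k  = inj₂ (inj₂ (inj₂ (refl , l<k)))

no-<ₚ-between-suc : ∀ {b j} q → (b , j) <ₚ q → q <ₚ (b , suc j) → ⊥
no-<ₚ-between-suc _ (inj₁ b<c)          (inj₁ c<b)         = ℕ.<-asym b<c c<b
no-<ₚ-between-suc _ (inj₁ b<c)          (inj₂ (refl , _))  = ℕ.<-irrefl refl b<c
no-<ₚ-between-suc _ (inj₂ (refl , _))   (inj₁ c<b)         = ℕ.<-irrefl refl c<b
no-<ₚ-between-suc _ (inj₂ (refl , j<l)) (inj₂ (_ , l<1+j)) = ℕ.<-irrefl refl (ℕ.<-≤-trans j<l (s≤s⁻¹ l<1+j))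

<ₚ-between-copies : ∀ {b k} q → (b , k) <ₚ q → q <ₚ (suc b , 0) → (proj₁ q ≡ b) × (k < proj₂ q)
<ₚ-between-copies _ (inj₁ b<c)          (inj₁ c<1+b)    = ⊥-elim (ℕ.<-irrefl refl (ℕ.<-≤-trans b<c (s≤s⁻¹ c<1+b)))
<ₚ-between-copies _ (inj₁ b<c)          (inj₂ (_ , ()))
<ₚ-between-copies _ (inj₂ (refl , k<l)) _               = refl , k<l

length-spellℕ : ∀ Q → length (spellℕ Q) ≡ length Q
length-spellℕ Q = trans (List.length-reverse (map proj₂ Q)) (List.length-map proj₂ Q)

actWord-spellℕ-∷ : ∀ x q Q → actWord x (spellℕ (q ∷ Q)) ≡ act (proj₂ q) (actWord x (spellℕ Q))
actWord-spellℕ-∷ x q Q =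
  trans (cong (actWord x) (List.unfold-reverse (proj₂ q) (map proj₂ Q))) (actWord-∷ʳ x (spellℕ Q) (proj₂ q))

actWord-spellℕ-tail : ∀ x q Q {u} → actWord x (spellℕ (q ∷ Q)) ≡ u → actWord x (spellℕ Q) ≡ act (proj₂ q) u
actWord-spellℕ-tail x q Q eq =
  trans (sym (act-involutive (proj₂ q) _)) (cong (act (proj₂ q)) (trans (sym (actWord-spellℕ-∷ x q Q)) eq))

HeadIn : (Posℕ → Set) → List Posℕ → Set
HeadIn Lo []      = ⊤
HeadIn Lo (q ∷ _) = Lo q

linked⇒HeadIn : ∀ {q Q} → Linked _<ₚ_ (q ∷ Q) → HeadIn (q <ₚ_) Q
linked⇒HeadIn [-]       = tt
linked⇒HeadIn (q<q' ∷ _) = q<q'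

module Greedy (n : ℕ) (x₀ : List ℤ) where

  SkippedAscents : (Posℕ → Set) → List ℤ → Posℕ → Set
  SkippedAscents Lo u g = ∀ q → proj₂ q < n → Lo q → q <ₚ g → ℓ (act (proj₂ q) u) ≡ suc (ℓ u)

  -- Greedy Lo u G: scanning the left-infinite word from the right through the positions
  -- satisfying Lo, with u still to be sorted, G takes positions one after another and every
  -- position passed over carries an ascent of what then remains to be sorted.
  data Greedy (Lo : Posℕ → Set) (u : List ℤ) : List Posℕ → Set where
    []   : Greedy Lo u []
    cons : ∀ {g G} → Lo g → SkippedAscents Lo u g → Greedy (g <ₚ_) (act (proj₂ g) u) G →
           Greedy Lo u (g ∷ G)

  ℓ-spellℕ-≤ : ∀ Q {u} → actWord x₀ (spellℕ Q) ≡ u → ℓ u ≤ length Q + ℓ x₀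
  ℓ-spellℕ-≤ Q refl = subst (λ m → ℓ (actWord x₀ (spellℕ Q)) ≤ m + ℓ x₀) (length-spellℕ Q)
                        (ℓ-actWord-≤ (spellℕ Q) x₀)

  greedy-≤Lex : ∀ {Lo u G Q} → Greedy Lo u G → actWord x₀ (spellℕ G) ≡ u → ℓ u ≡ length G + ℓ x₀ →
    Linked _<ₚ_ Q → All (λ q → proj₂ q < n) Q → HeadIn Lo Q → actWord x₀ (spellℕ Q) ≡ u →
    length Q ≤ length G → G ≤Lexℕ Q
  greedy-≤Lex {Q = []}    []           _  _  _ _ _ _ _ = tt
  greedy-≤Lex {Q = _ ∷ _} []           _  _  _ _ _ _ ()
  greedy-≤Lex {Q = []}    (cons _ _ _) _  ℓu _ _ _ eQ _ = ⊥-elim (ℕ.m≢1+n+m _ (trans (cong ℓ eQ) ℓu))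
  greedy-≤Lex {u = u} {g ∷ G} {q ∷ Q} (cons _ skipped G-greedy) eG ℓu LQ (q<n ∷ Q<n) q-in eQ (s≤s |Q|≤|G|)
    with <ₚ-trichotomous q g
  ... | inj₁ q<g = ⊥-elim (ℕ.<⇒≱ too-long (ℕ.≤-trans (ℕ.+-monoˡ-≤ (ℓ x₀) |Q|≤|G|) (ℕ.n≤1+n _)))
    where
    too-long : suc (length G + ℓ x₀) < length Q + ℓ x₀
    too-long = subst (_≤ length Q + ℓ x₀) (trans (skipped q q<n q-in q<g) (cong suc ℓu))
                 (ℓ-spellℕ-≤ Q (actWord-spellℕ-tail x₀ q Q eQ))
  ... | inj₂ (inj₂ g<q) = inj₁ g<q
  ... | inj₂ (inj₁ refl) = inj₂ (refl , greedy-≤Lex G-greedy eG' ℓ-descent (Linked.tail LQ) Q<n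
                                          (linked⇒HeadIn LQ) (actWord-spellℕ-tail x₀ q Q eQ) |Q|≤|G|)
    where
    eG' : actWord x₀ (spellℕ G) ≡ act (proj₂ q) u
    eG' = actWord-spellℕ-tail x₀ q G eG
    ℓ-descent : ℓ (act (proj₂ q) u) ≡ length G + ℓ x₀
    ℓ-descent = ℕ.≤-antisym (ℓ-spellℕ-≤ G eG')
      (s≤s⁻¹ (subst (_≤ suc (ℓ (act (proj₂ q) u))) (trans (cong ℓ (act-involutive (proj₂ q) u)) ℓu)
                (ℓ-act-≤ (proj₂ q) (act (proj₂ q) u))))

applyUpTo-cong : ∀ {A : Set} {f g : ℕ → A} n → (∀ {i} → i < n → f i ≡ g i) → applyUpTo f n ≡ applyUpTo g n
applyUpTo-cong {f = f} {g} n f≗g = begin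
  applyUpTo f n    ≡⟨ List.map-upTo f n ⟨
  map f (upTo n)   ≡⟨ List.map-cong-local (All.applyUpTo⁺₁ (λ i → i) n f≗g) ⟩
  map g (upTo n)   ≡⟨ List.map-upTo g n ⟩
  applyUpTo g n    ∎
  where open ≡-Reasoning

applyUpTo-injective : ∀ {A : Set} (f g : ℕ → A) n → applyUpTo f n ≡ applyUpTo g n → ∀ {i} → i < n → f i ≡ g i
applyUpTo-injective f g (suc n) eq {zero}  _         = List.∷-injectiveˡ eq
applyUpTo-injective f g (suc n) eq {suc i} (s≤s i<n) =
  applyUpTo-injective (f ∘ suc) (g ∘ suc) n (List.∷-injectiveʳ eq) i<n

rightPart : Window → ℕ → List ℤ
rightPart u n = applyUpTo (λ i → u (suc i)) n

rightPart-rmul : ∀ k f n → k < n → rightPart (rmul k f) n ≡ act k (rightPart f n)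
rightPart-rmul zero          f (suc n)       _         = refl
rightPart-rmul (suc zero)    f (suc (suc n)) _         = refl
rightPart-rmul (suc zero)    f (suc zero)    (s≤s ())
rightPart-rmul (suc (suc k)) f (suc n)       (s≤s k<n) = cong (f 1 ∷_) (rightPart-rmul (suc k) (f ∘ suc) n k<n)

rightPart-foldl : ∀ n (V : Word n) f →
  rightPart (foldl (λ f k → rmul (toℕ k) f) f V) n ≡ actWord (rightPart f n) (map toℕ V)
rightPart-foldl n []      f = refl
rightPart-foldl n (k ∷ V) f = trans (rightPart-foldl n V (rmul (toℕ k) f))
  (cong (λ x → actWord x (map toℕ V)) (rightPart-rmul (toℕ k) f n (Fin.toℕ<n k)))

rightPart-eval : ∀ n (V : Word n) → rightPart (eval V) n ≡ actWord (rightPart idW n) (map toℕ V)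
rightPart-eval n V = rightPart-foldl n V idW

≈⇒rightPart≡ : ∀ {u v} n → u ≈[ n ] v → rightPart u n ≡ rightPart v n
≈⇒rightPart≡ n u≈v = applyUpTo-cong n (λ i<n → u≈v _ (s≤s z≤n) i<n)

rightPart≡⇒≈ : ∀ {u v} n → rightPart u n ≡ rightPart v n → u ≈[ n ] v
rightPart≡⇒≈ {u} {v} n eq (suc j) _ j<n = applyUpTo-injective (u ∘ suc) (v ∘ suc) n eq j<n

module _ {n : ℕ} where

  toPosℕ : Pos n → Posℕ
  toPosℕ (b , k) = b , toℕ k

  fromPosℕ : ∀ (P : List Posℕ) → All (λ q → proj₂ q < n) P → Σ (List (Pos n)) λ P' → map toPosℕ P' ≡ P
  fromPosℕ []            []          = [] , refl
  fromPosℕ ((b , k) ∷ P) (k<n ∷ P<n) with fromPosℕ P P<n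
  ... | P' , eq = (b , fromℕ< k<n) ∷ P' , cong₂ _∷_ (cong (b ,_) (Fin.toℕ-fromℕ< k<n)) eq

  toPosℕ-injective : ∀ {p q} → toPosℕ p ≡ toPosℕ q → p ≡ q
  toPosℕ-injective eq = cong₂ _,_ (cong proj₁ eq) (Fin.toℕ-injective (cong proj₂ eq))

  ≤Lexℕ⇒≤Lex : ∀ (P Q : List (Pos n)) → map toPosℕ P ≤Lexℕ map toPosℕ Q → P ≤Lex Q
  ≤Lexℕ⇒≤Lex []      []      _                = tt
  ≤Lexℕ⇒≤Lex (p ∷ P) (q ∷ Q) (inj₁ p<q)       = inj₁ p<q
  ≤Lexℕ⇒≤Lex (p ∷ P) (q ∷ Q) (inj₂ (eq , le)) = inj₂ (toPosℕ-injective eq , ≤Lexℕ⇒≤Lex P Q le)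

  linked-toPosℕ : ∀ {P} → Linked _<P_ P → Linked _<ₚ_ (map toPosℕ P)
  linked-toPosℕ = Linked.map⁺

  linked-fromPosℕ : ∀ {P} → Linked _<ₚ_ (map toPosℕ P) → Linked _<P_ P
  linked-fromPosℕ = Linked.map⁻

  spell-toPosℕ : ∀ (P : List (Pos n)) → map toℕ (spell P) ≡ spellℕ (map toPosℕ P)
  spell-toPosℕ P = trans (List.reverse-map toℕ (map proj₂ P))
    (cong reverse (trans (sym (List.map-∘ P)) (List.map-∘ P)))

  length-spell : ∀ (P : List (Pos n)) → length (spell P) ≡ length (map toPosℕ P)
  length-spell P = trans (List.length-reverse (map proj₂ P))
    (trans (List.length-map proj₂ P) (sym (List.length-map toPosℕ P)))

  letters<-toPosℕ : ∀ (P : List (Pos n)) → All (λ q → proj₂ q < n) (map toPosℕ P)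
  letters<-toPosℕ P = All.map⁺ (All.universal (λ p → Fin.toℕ<n (proj₂ p)) P)

HeadIn-⊤ : ∀ Q → HeadIn (λ _ → ⊤) Q
HeadIn-⊤ []      = tt
HeadIn-⊤ (_ ∷ _) = tt

ℓ≡length⇒reduced : ∀ n w (W : Word n) → rightPart (eval W) n ≡ rightPart w n →
  ℓ (rightPart w n) ≡ length W + ℓ (rightPart idW n) → IsReducedWordFor n w W
ℓ≡length⇒reduced n w W evalW ℓw = rightPart≡⇒≈ n evalW , shortest
  where
  shortest : ∀ V → eval V ≈[ n ] w → length W ≤ length V
  shortest V evalV = ℕ.+-cancelʳ-≤ (ℓ (rightPart idW n)) (length W) (length V)
    (subst₂ (λ a b → a ≤ b + ℓ (rightPart idW n))
      (trans (cong ℓ (trans (sym (rightPart-eval n V)) (≈⇒rightPart≡ n evalV))) ℓw) (List.length-map toℕ V)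
      (ℓ-actWord-≤ (map toℕ V) (rightPart idW n)))

rightPart-eval-spell : ∀ {n} (P : List (Pos n)) →
  rightPart (eval (spell P)) n ≡ actWord (rightPart idW n) (spellℕ (map toPosℕ P))
rightPart-eval-spell {n} P = trans (rightPart-eval n (spell P)) (cong (actWord (rightPart idW n)) (spell-toPosℕ P))

module _ (n : ℕ) where

  open Greedy n (rightPart idW n)

  greedy⇒IsSortingWord : ∀ w (Pₙ : List Posℕ) → Linked _<ₚ_ Pₙ → All (λ q → proj₂ q < n) Pₙ →
    Greedy (λ _ → ⊤) (rightPart w n) Pₙ → actWord (rightPart idW n) (spellℕ Pₙ) ≡ rightPart w n →
    ℓ (rightPart w n) ≡ length Pₙ + ℓ (rightPart idW n) →
    Σ (List (Pos n)) λ P → (map toPosℕ P ≡ Pₙ) × IsSortingWord n w (spell P)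
  greedy⇒IsSortingWord w Pₙ linked letters< greedy evalPₙ ℓw =
    P , P≡ , reduced , P , linked-fromPosℕ (subst (Linked _<ₚ_) (sym P≡) linked) , refl , leftmost
    where
    P : List (Pos n)
    P = proj₁ (fromPosℕ Pₙ letters<)
    P≡ : map toPosℕ P ≡ Pₙ
    P≡ = proj₂ (fromPosℕ Pₙ letters<)
    length-P : length (spell P) ≡ length Pₙ
    length-P = trans (length-spell P) (cong length P≡)
    reduced : IsReducedWordFor n w (spell P)
    reduced = ℓ≡length⇒reduced n w (spell P)
      (trans (rightPart-eval-spell P) (trans (cong (actWord _ ∘ spellℕ) P≡) evalPₙ))
      (trans ℓw (cong (_+ ℓ (rightPart idW n)) (sym length-P)))
    leftmost : ∀ Q → Linked _<P_ Q → IsReducedWordFor n w (spell Q) → P ≤Lex Q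
    leftmost Q linked-Q (evalQ , shortestQ) = ≤Lexℕ⇒≤Lex P Q (subst (_≤Lexℕ map toPosℕ Q) (sym P≡)
      (greedy-≤Lex greedy evalPₙ ℓw (linked-toPosℕ linked-Q) (letters<-toPosℕ Q) (HeadIn-⊤ (map toPosℕ Q))
        (trans (sym (rightPart-eval-spell Q)) (≈⇒rightPart≡ n evalQ))
        (subst₂ _≤_ (length-spell Q) length-P (shortestQ (spell P) (proj₁ reduced)))))

countUp : ℕ → ℕ → List ℕ
countUp a zero    = []
countUp a (suc i) = a ∷ countUp (suc a) i

length-countUp : ∀ a i → length (countUp a i) ≡ i
length-countUp a zero    = refl
length-countUp a (suc i) = cong suc (length-countUp (suc a) i)

countUp-+ : ∀ a i j → countUp a (i + j) ≡ countUp a i ++ countUp (a + i) j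
countUp-+ a zero    j = cong (λ b → countUp b j) (sym (ℕ.+-identityʳ a))
countUp-+ a (suc i) j = cong (a ∷_)
  (trans (countUp-+ (suc a) i j) (cong (λ b → countUp (suc a) i ++ countUp b j) (sym (ℕ.+-suc a i))))

countUp≡applyUpTo : ∀ a i → countUp a i ≡ applyUpTo (a +_) i
countUp≡applyUpTo a zero    = refl
countUp≡applyUpTo a (suc i) = cong₂ _∷_ (sym (ℕ.+-identityʳ a))
  (trans (countUp≡applyUpTo (suc a) i) (applyUpTo-cong i (λ {k} _ → sym (ℕ.+-suc a k))))

-- The factors s_{k…0} of the claimed word, listed from the last one applied (the rightmost) to the first.
factorIndices : ℕ → List ℕ → List ℕ
factorIndices n []         = []
factorIndices n (i ∷ rest) = reverse (countUp (n ∸ i) i) ++ factorIndices n rest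

applyFactors : List ℕ → List ℤ → List ℤ
applyFactors rk x = foldr actDown x rk

concatMap-sDown-reverse : ∀ k rk → concatMap sDown (reverse (k ∷ rk)) ≡ concatMap sDown (reverse rk) ++ sDown k
concatMap-sDown-reverse k rk = begin
  concatMap sDown (reverse (k ∷ rk))
    ≡⟨ cong (concatMap sDown) (List.unfold-reverse k rk) ⟩
  concatMap sDown (reverse rk ++ [ k ])
    ≡⟨ List.concatMap-++ sDown (reverse rk) [ k ] ⟩
  concatMap sDown (reverse rk) ++ concatMap sDown [ k ]
    ≡⟨ cong (concatMap sDown (reverse rk) ++_) (List.++-identityʳ (sDown k)) ⟩
  concatMap sDown (reverse rk) ++ sDown k ∎
  where open ≡-Reasoning

applyFactors-actWord : ∀ rk x → applyFactors rk x ≡ actWord x (concatMap sDown (reverse rk))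
applyFactors-actWord []       x = refl
applyFactors-actWord (k ∷ rk) x = begin
  actDown k (applyFactors rk x)
    ≡⟨ cong (actDown k) (applyFactors-actWord rk x) ⟩
  actWord (actWord x (concatMap sDown (reverse rk))) (sDown k)
    ≡⟨ actWord-++ x (concatMap sDown (reverse rk)) (sDown k) ⟨
  actWord x (concatMap sDown (reverse rk) ++ sDown k)
    ≡⟨ cong (actWord x) (concatMap-sDown-reverse k rk) ⟨
  actWord x (concatMap sDown (reverse (k ∷ rk))) ∎
  where open ≡-Reasoning

claimedWord-factorIndices : ∀ n rest → claimedWord n rest ≡ concatMap sDown (reverse (factorIndices n rest))
claimedWord-factorIndices n []         = refl
claimedWord-factorIndices n (i ∷ rest) = begin
  concatMap (Rblock n) (reverse (i ∷ rest))
    ≡⟨ cong (concatMap (Rblock n)) (List.unfold-reverse i rest) ⟩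
  concatMap (Rblock n) (reverse rest ++ [ i ])
    ≡⟨ List.concatMap-++ (Rblock n) (reverse rest) [ i ] ⟩
  claimedWord n rest ++ (Rblock n i ++ [])
    ≡⟨ cong₂ _++_ (claimedWord-factorIndices n rest) (trans (List.++-identityʳ _) block) ⟩
  concatMap sDown (reverse (factorIndices n rest)) ++ concatMap sDown (countUp (n ∸ i) i)
    ≡⟨ List.concatMap-++ sDown (reverse (factorIndices n rest)) (countUp (n ∸ i) i) ⟨
  concatMap sDown (reverse (factorIndices n rest) ++ countUp (n ∸ i) i)
    ≡⟨ cong (λ t → concatMap sDown (reverse (factorIndices n rest) ++ t)) (List.reverse-involutive _) ⟨
  concatMap sDown (reverse (factorIndices n rest) ++ reverse (reverse (countUp (n ∸ i) i)))
    ≡⟨ cong (concatMap sDown) (List.reverse-++ (reverse (countUp (n ∸ i) i)) (factorIndices n rest)) ⟨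
  concatMap sDown (reverse (factorIndices n (i ∷ rest))) ∎
  where
  open ≡-Reasoning
  block : Rblock n i ≡ concatMap sDown (countUp (n ∸ i) i)
  block = trans (sym (List.concatMap-map sDown (n ∸ i +_) (upTo i)))
    (cong (concatMap sDown) (trans (List.map-applyUpTo (λ j → j) (n ∸ i +_) i) (sym (countUp≡applyUpTo (n ∸ i) i))))

ascending : ℕ → ℕ → List ℤ
ascending S m = map (λ k → ℤ.+ suc k) (countUp S m)

length-ascending : ∀ S m → length (ascending S m) ≡ m
length-ascending S m = trans (List.length-map _ (countUp S m)) (length-countUp S m)

ascending-+ : ∀ S i j → ascending S (i + j) ≡ ascending S i ++ ascending (S + i) j
ascending-+ S i j = trans (cong (map _) (countUp-+ S i j)) (List.map-++ _ (countUp S i) _)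

length-runs : ∀ S rest → length (runs S rest) ≡ sumL rest
length-runs S []         = refl
length-runs S (i ∷ rest) = begin
  length (run S i ++ runs (S + i) rest)          ≡⟨ List.length-++ (run S i) ⟩
  length (run S i) + length (runs (S + i) rest)  ≡⟨ cong₂ _+_ |run| (length-runs (S + i) rest) ⟩
  i + sumL rest                                  ∎
  where
  open ≡-Reasoning
  |run| : length (run S i) ≡ i
  |run| = trans (List.length-map _ (upTo i)) (List.length-upTo i)

run-∷ʳ : ∀ S i → run S (suc i) ≡ run (suc S) i ++ [ - ℤ.+ suc S ]
run-∷ʳ S i = begin
  map f (upTo (suc i))              ≡⟨ cong (map f) (List.upTo-∷ʳ i) ⟨
  map f (upTo i ++ [ i ])           ≡⟨ List.map-++ f (upTo i) [ i ] ⟩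
  map f (upTo i) ++ [ f i ]         ≡⟨ cong₂ (λ xs x → xs ++ [ x ]) (List.map-cong shift (upTo i)) last ⟩
  run (suc S) i ++ [ - ℤ.+ suc S ]  ∎
  where
  open ≡-Reasoning
  f : ℕ → ℤ
  f k = - ℤ.+ (S + suc i ∸ k)
  shift : ∀ k → f k ≡ - ℤ.+ (suc S + i ∸ k)
  shift k = cong (λ m → - ℤ.+ (m ∸ k)) (ℕ.+-suc S i)
  last : f i ≡ - ℤ.+ suc S
  last = trans (shift i) (cong (λ m → - ℤ.+ m) (ℕ.m+n∸n≡m (suc S) i))

neg-reverse-ascending : ∀ S i → map -_ (reverse (ascending S i)) ≡ run S i
neg-reverse-ascending S zero    = refl
neg-reverse-ascending S (suc i) = begin
  map -_ (reverse (ℤ.+ suc S ∷ ascending (suc S) i))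
    ≡⟨ cong (map -_) (List.unfold-reverse _ (ascending (suc S) i)) ⟩
  map -_ (reverse (ascending (suc S) i) ++ [ ℤ.+ suc S ])
    ≡⟨ List.map-++ -_ (reverse (ascending (suc S) i)) _ ⟩
  map -_ (reverse (ascending (suc S) i)) ++ [ - ℤ.+ suc S ]
    ≡⟨ cong (_++ _) (neg-reverse-ascending (suc S) i) ⟩
  run (suc S) i ++ [ - ℤ.+ suc S ]
    ≡⟨ run-∷ʳ S i ⟨
  run S (suc i) ∎
  where open ≡-Reasoning

applyFactors-block : ∀ P B → applyFactors (reverse (countUp (length P) (length B))) (P ++ B) ≡ map -_ (reverse B) ++ P
applyFactors-block P []      = List.++-identityʳ P
applyFactors-block P (b ∷ B) = begin
  applyFactors (reverse (length P ∷ block)) (P ++ b ∷ B)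
    ≡⟨ cong (λ t → applyFactors t (P ++ b ∷ B)) (List.unfold-reverse (length P) block) ⟩
  applyFactors (reverse block ++ [ length P ]) (P ++ b ∷ B)
    ≡⟨ List.foldr-++ actDown (P ++ b ∷ B) (reverse block) [ length P ] ⟩
  applyFactors (reverse block) (actDown (length P) (P ++ b ∷ B))
    ≡⟨ cong (applyFactors (reverse block)) (actDown-++ P b B) ⟩
  applyFactors (reverse block) ((- b ∷ P) ++ B)
    ≡⟨ applyFactors-block (- b ∷ P) B ⟩
  map -_ (reverse B) ++ - b ∷ P
    ≡⟨ List.∷ʳ-++ (map -_ (reverse B)) (- b) P ⟨
  (map -_ (reverse B) ++ [ - b ]) ++ P
    ≡⟨ cong (_++ P) (List.map-++ -_ (reverse B) [ b ]) ⟨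
  map -_ (reverse B ++ [ b ]) ++ P
    ≡⟨ cong (λ t → map -_ t ++ P) (List.unfold-reverse b B) ⟨
  map -_ (reverse (b ∷ B)) ++ P ∎
  where
  open ≡-Reasoning
  block : List ℕ
  block = countUp (suc (length P)) (length B)

applyFactors-runs : ∀ n S rest A → length A ≡ S → S + sumL rest ≡ n →
  applyFactors (factorIndices n rest) (A ++ ascending S (sumL rest)) ≡ runs S rest ++ A
applyFactors-runs n S []         A _   _ = List.++-identityʳ A
applyFactors-runs n S (i ∷ rest) A |A| S+i+s≡n = begin
  applyFactors (block ++ factorIndices n rest) (A ++ ascending S (i + s))
    ≡⟨ List.foldr-++ actDown _ block (factorIndices n rest) ⟩
  applyFactors block (applyFactors (factorIndices n rest) (A ++ ascending S (i + s)))
    ≡⟨ cong (λ t → applyFactors block (applyFactors (factorIndices n rest) t)) split ⟩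
  applyFactors block (applyFactors (factorIndices n rest) ((A ++ ascending S i) ++ ascending (S + i) s))
    ≡⟨ cong (applyFactors block) (applyFactors-runs n (S + i) rest (A ++ ascending S i) |A'| S+i+s≡n') ⟩
  applyFactors block (runs (S + i) rest ++ A ++ ascending S i)
    ≡⟨ cong (applyFactors block) (List.++-assoc (runs (S + i) rest) A _) ⟨
  applyFactors block ((runs (S + i) rest ++ A) ++ ascending S i)
    ≡⟨ cong₂ (λ a m → applyFactors (reverse (countUp a m)) ((runs (S + i) rest ++ A) ++ ascending S i))
             index (length-ascending S i) ⟨
  applyFactors (reverse (countUp (length (runs (S + i) rest ++ A)) (length (ascending S i))))
               ((runs (S + i) rest ++ A) ++ ascending S i)
    ≡⟨ applyFactors-block (runs (S + i) rest ++ A) (ascending S i) ⟩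
  map -_ (reverse (ascending S i)) ++ runs (S + i) rest ++ A
    ≡⟨ cong (_++ runs (S + i) rest ++ A) (neg-reverse-ascending S i) ⟩
  run S i ++ runs (S + i) rest ++ A
    ≡⟨ List.++-assoc (run S i) (runs (S + i) rest) A ⟨
  runs S (i ∷ rest) ++ A ∎
  where
  open ≡-Reasoning
  s = sumL rest
  block = reverse (countUp (n ∸ i) i)
  split : A ++ ascending S (i + s) ≡ (A ++ ascending S i) ++ ascending (S + i) s
  split = trans (cong (A ++_) (ascending-+ S i s)) (sym (List.++-assoc A _ _))
  |A'| : length (A ++ ascending S i) ≡ S + i
  |A'| = trans (List.length-++ A) (cong₂ _+_ |A| (length-ascending S i))
  S+i+s≡n' : S + i + s ≡ n
  S+i+s≡n' = trans (ℕ.+-assoc S i s) S+i+s≡n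
  index : length (runs (S + i) rest ++ A) ≡ n ∸ i
  index = begin
    length (runs (S + i) rest ++ A)  ≡⟨ List.length-++ (runs (S + i) rest) ⟩
    length (runs (S + i) rest) + length A
                                     ≡⟨ cong₂ _+_ (length-runs (S + i) rest) |A| ⟩
    s + S                            ≡⟨ ℕ.m+n∸m≡n i (s + S) ⟨
    i + (s + S) ∸ i                  ≡⟨ cong (_∸ i) (trans (reorder i s S) S+i+s≡n') ⟩
    n ∸ i                            ∎
    where
    open +-*-Solver using (solve; _:+_; _:=_)
    reorder : ∀ i s S → i + (s + S) ≡ S + i + s
    reorder = solve 3 (λ i s S → i :+ (s :+ S) := S :+ i :+ s) refl

rightPart-idW : ∀ n → rightPart idW n ≡ ascending 0 n
rightPart-idW n = sym (trans (cong (map _) (countUp≡applyUpTo 0 n)) (List.map-applyUpTo (λ i → i) _ n))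

applyFactors-target : ∀ i₁ rest →
  applyFactors (factorIndices (i₁ + sumL rest) rest) (rightPart idW (i₁ + sumL rest)) ≡ targetWindow i₁ rest
applyFactors-target i₁ rest = begin
  applyFactors rk (rightPart idW (i₁ + sumL rest))
    ≡⟨ cong (applyFactors rk) (rightPart-idW (i₁ + sumL rest)) ⟩
  applyFactors rk (ascending 0 (i₁ + sumL rest))
    ≡⟨ cong (applyFactors rk) (ascending-+ 0 i₁ (sumL rest)) ⟩
  applyFactors rk (ascending 0 i₁ ++ ascending i₁ (sumL rest))
    ≡⟨ applyFactors-runs _ i₁ rest (ascending 0 i₁) (length-ascending 0 i₁) refl ⟩
  runs i₁ rest ++ ascending 0 i₁
    ≡⟨ cong (λ t → runs i₁ rest ++ map _ t) (countUp≡applyUpTo 0 i₁) ⟩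
  targetWindow i₁ rest ∎
  where
  open ≡-Reasoning
  rk = factorIndices (i₁ + sumL rest) rest

-- rk lists factors from the last applied, so `length rk` counts the factors applied before k.
Admissible : ℕ → ℕ → List ℕ → Set
Admissible n o []       = ⊤
Admissible n o (k ∷ rk) = (o + length rk ≤ k) × (k < n) × Admissible n o rk

Admissible-++ : ∀ n o A B → Admissible n (o + length B) A → Admissible n o B → Admissible n o (A ++ B)
Admissible-++ n o []      B _                 admB = admB
Admissible-++ n o (k ∷ A) B (le , k<n , admA) admB =
  subst (_≤ k) (trans (ℕ.+-assoc o (length B) (length A))
    (cong (o +_) (trans (ℕ.+-comm (length B) (length A)) (sym (List.length-++ A))))) le
  , k<n , Admissible-++ n o A B admA admB

Admissible-block : ∀ n o a i → o ≤ a → a + i ≤ n → Admissible n o (reverse (countUp a i))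
Admissible-block n o a zero    _   _    = tt
Admissible-block n o a (suc i) o≤a a+i≤n =
  subst (Admissible n o) (sym (List.unfold-reverse a (countUp (suc a) i)))
    (Admissible-++ n o (reverse (countUp (suc a) i)) [ a ]
      (Admissible-block n (o + 1) (suc a) i (subst (_≤ suc a) (ℕ.+-comm 1 o) (s≤s o≤a))
        (subst (_≤ n) (ℕ.+-suc a i) a+i≤n))
      (subst (_≤ a) (sym (ℕ.+-identityʳ o)) o≤a , ℕ.<-≤-trans (ℕ.m<m+n a (s≤s z≤n)) a+i≤n , tt))

length-factorIndices : ∀ n rest → length (factorIndices n rest) ≡ sumL rest
length-factorIndices n []         = refl
length-factorIndices n (i ∷ rest) = trans (List.length-++ (reverse (countUp (n ∸ i) i)))
  (cong₂ _+_ (trans (List.length-reverse (countUp (n ∸ i) i)) (length-countUp (n ∸ i) i))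
             (length-factorIndices n rest))

Admissible-factorIndices : ∀ n rest → sumL rest ≤ n → Admissible n 0 (factorIndices n rest)
Admissible-factorIndices n []         _ = tt
Admissible-factorIndices n (i ∷ rest) i+s≤n =
  Admissible-++ n 0 (reverse (countUp (n ∸ i) i)) (factorIndices n rest)
    (subst (λ o → Admissible n o (reverse (countUp (n ∸ i) i))) (sym (length-factorIndices n rest))
      (Admissible-block n (sumL rest) (n ∸ i) i
        (ℕ.m+n≤o⇒m≤o∸n (sumL rest) (subst (_≤ n) (ℕ.+-comm i (sumL rest)) i+s≤n))
        (ℕ.≤-reflexive (ℕ.m∸n+n≡m (ℕ.m+n≤o⇒m≤o i i+s≤n)))))
    (Admissible-factorIndices n rest (ℕ.m+n≤o⇒n≤o i i+s≤n))

-- The factor s_{k…0} applied b-th from the end occupies the letters s_0, …, s_k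
-- of the b-th copy of s_{n-1}⋯s_0 from the right.
segment : ℕ → ℕ → ℕ → List Posℕ
segment b j k = map (b ,_) (countUp j (suc k))

positions : ℕ → List ℕ → List Posℕ
positions b []       = []
positions b (k ∷ rk) = segment b 0 k ++ positions (suc b) rk

wordLength : List ℕ → ℕ
wordLength rk = sum (map suc rk)

spellℕ-++ : ∀ P Q → spellℕ (P ++ Q) ≡ spellℕ Q ++ spellℕ P
spellℕ-++ P Q = trans (cong reverse (List.map-++ proj₂ P Q)) (List.reverse-++ (map proj₂ P) (map proj₂ Q))

spellℕ-segment : ∀ b k → spellℕ (segment b 0 k) ≡ sDown k
spellℕ-segment b k = begin
  reverse (map proj₂ (map (b ,_) (countUp 0 (suc k))))
    ≡⟨ cong reverse (List.map-∘ (countUp 0 (suc k))) ⟨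
  reverse (map (λ j → j) (countUp 0 (suc k)))
    ≡⟨ cong reverse (trans (List.map-id _) (countUp≡applyUpTo 0 (suc k))) ⟩
  reverse (upTo (suc k))
    ≡⟨ cong reverse (List.reverse-downFrom (suc k)) ⟨
  reverse (reverse (sDown k))
    ≡⟨ List.reverse-involutive (sDown k) ⟩
  sDown k ∎
  where open ≡-Reasoning

spellℕ-positions : ∀ b rk → spellℕ (positions b rk) ≡ concatMap sDown (reverse rk)
spellℕ-positions b []       = refl
spellℕ-positions b (k ∷ rk) = begin
  spellℕ (segment b 0 k ++ positions (suc b) rk)
    ≡⟨ spellℕ-++ (segment b 0 k) (positions (suc b) rk) ⟩
  spellℕ (positions (suc b) rk) ++ spellℕ (segment b 0 k)
    ≡⟨ cong₂ _++_ (spellℕ-positions (suc b) rk) (spellℕ-segment b k) ⟩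
  concatMap sDown (reverse rk) ++ sDown k
    ≡⟨ concatMap-sDown-reverse k rk ⟨
  concatMap sDown (reverse (k ∷ rk)) ∎
  where open ≡-Reasoning

linked-segment : ∀ b j k P → Linked _<ₚ_ P → HeadIn (λ q → b < proj₁ q) P → Linked _<ₚ_ (segment b j k ++ P)
linked-segment b j zero          []      _ _   = [-]
linked-segment b j zero          (q ∷ P) L b<q = inj₁ b<q ∷ L
linked-segment b j (suc zero)    P       L b<P = inj₂ (refl , ℕ.n<1+n j) ∷ linked-segment b (suc j) zero P L b<P
linked-segment b j (suc (suc k)) P       L b<P = inj₂ (refl , ℕ.n<1+n j) ∷ linked-segment b (suc j) (suc k) P L b<P

linked-positions : ∀ b rk → Linked _<ₚ_ (positions b rk)
linked-positions b []       = []
linked-positions b (k ∷ rk) = linked-segment b 0 k (positions (suc b) rk) (linked-positions (suc b) rk) (later rk)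
  where
  later : ∀ rk → HeadIn (λ q → b < proj₁ q) (positions (suc b) rk)
  later []      = tt
  later (_ ∷ _) = ℕ.n<1+n b

length-positions : ∀ b rk → length (positions b rk) ≡ wordLength rk
length-positions b []       = refl
length-positions b (k ∷ rk) = trans (List.length-++ (segment b 0 k))
  (cong₂ _+_ (trans (List.length-map _ (countUp 0 (suc k))) (length-countUp 0 (suc k))) (length-positions (suc b) rk))

letters<-positions : ∀ n b rk → All (_< n) rk → All (λ q → proj₂ q < n) (positions b rk)
letters<-positions n b []       []           = []
letters<-positions n b (k ∷ rk) (k<n ∷ rk<n) =
  All.++⁺ (All.map⁺ (All.map (λ {j} j≤k → ℕ.≤-<-trans j≤k k<n) (upTo≤ k)))
          (letters<-positions n (suc b) rk rk<n)
  where
  upTo≤ : ∀ k → All (_≤ k) (countUp 0 (suc k))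
  upTo≤ k = subst (All (_≤ k)) (sym (countUp≡applyUpTo 0 (suc k)))
              (All.applyUpTo⁺₁ (λ j → j) (suc k) s≤s⁻¹)

Admissible⇒All< : ∀ n o rk → Admissible n o rk → All (_< n) rk
Admissible⇒All< n o []       _                = []
Admissible⇒All< n o (k ∷ rk) (_ , k<n , adm) = k<n ∷ Admissible⇒All< n o rk adm

module Sorting (n : ℕ) where

  idₙ : List ℤ
  idₙ = rightPart idW n

  open Greedy n idₙ public

  length-applyFactors : ∀ rk → length (applyFactors rk idₙ) ≡ n
  length-applyFactors []       = List.length-applyUpTo _ n
  length-applyFactors (k ∷ rk) = trans (length-actWord (sDown k) (applyFactors rk idₙ)) (length-applyFactors rk)

  NegAsc-idₙ : NegAsc 0 idₙ
  NegAsc-idₙ = negAsc [] (Linked.applyUpTo⁺₂ _ n (λ i → ℤ.+<+ (ℕ.n<1+n (suc i))))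
                         (All.applyUpTo⁺₂ _ n (λ i → ℤ.+<+ (s≤s z≤n)))

  FactorAscents : List ℕ → Set
  FactorAscents []       = ⊤
  FactorAscents (k ∷ rk) = Ascents k (applyFactors rk idₙ) × FactorAscents rk

  applyFactors-NegAsc : ∀ rk → Admissible n 0 rk →
    NegAsc (length rk) (applyFactors rk idₙ) × (ℓ (applyFactors rk idₙ) ≡ wordLength rk + ℓ idₙ) × FactorAscents rk
  applyFactors-NegAsc []       _                 = NegAsc-idₙ , refl , tt
  applyFactors-NegAsc (k ∷ rk) (j≤k , k<n , adm) with applyFactors-NegAsc rk adm
  ... | negAsc-y , ℓy , ascents with actDown-NegAsc negAsc-y j≤k (subst (k <_) (sym (length-applyFactors rk)) k<n)
  ...   | negAsc-y' , ℓy' = negAsc-y' , ℓ-step , ascents-y , ascents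
    where
    ℓ-step : ℓ (actDown k (applyFactors rk idₙ)) ≡ wordLength (k ∷ rk) + ℓ idₙ
    ℓ-step = trans ℓy' (trans (cong (λ t → k + suc t) ℓy)
               (trans (ℕ.+-suc k _) (cong suc (sym (ℕ.+-assoc k (wordLength rk) (ℓ idₙ))))))
    ascents-y : Ascents k (applyFactors rk idₙ)
    ascents-y l k<l = NegAsc⇒Ascents negAsc-y l (ℕ.≤-<-trans j≤k k<l)

  segment-Greedy : ∀ b j k u Lo P → Lo (b , j) → SkippedAscents Lo u (b , j) →
    Greedy ((b , j + k) <ₚ_) (actWord u (countUp j (suc k))) P → Greedy Lo u (segment b j k ++ P)
  segment-Greedy b j zero    u Lo P lo skipped rest =
    cons lo skipped (subst (λ m → Greedy ((b , m) <ₚ_) (act j u) P) (ℕ.+-identityʳ j) rest)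
  segment-Greedy b j (suc k) u Lo P lo skipped rest =
    cons lo skipped (segment-Greedy b (suc j) k (act j u) ((b , j) <ₚ_) P (inj₂ (refl , ℕ.n<1+n j)) nothing-skipped
      (subst (λ m → Greedy ((b , m) <ₚ_) (actWord u (countUp j (suc (suc k)))) P) (ℕ.+-suc j k) rest))
    where
    nothing-skipped : SkippedAscents ((b , j) <ₚ_) (act j u) (b , suc j)
    nothing-skipped q _ after before = ⊥-elim (no-<ₚ-between-suc q after before)

  actWord-actDown : ∀ k y → actWord (actDown k y) (countUp 0 (suc k)) ≡ y
  actWord-actDown k y = begin
    actWord (actDown k y) (countUp 0 (suc k))          ≡⟨ cong (actWord (actDown k y)) (countUp≡applyUpTo 0 (suc k)) ⟩
    actWord (actDown k y) (upTo (suc k))               ≡⟨ cong (actWord (actDown k y)) (List.reverse-downFrom (suc k)) ⟨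
    actWord (actWord y (sDown k)) (reverse (sDown k))  ≡⟨ actWord-reverse (sDown k) y ⟩
    y                                                  ∎
    where open ≡-Reasoning

  StartsAt : (Posℕ → Set) → ℕ → List ℕ → Set
  StartsAt Lo b []       = ⊤
  StartsAt Lo b (k ∷ rk) = Lo (b , 0) × SkippedAscents Lo (applyFactors (k ∷ rk) idₙ) (b , 0)

  -- Between the segment ending at (b , k) and the next one lie the letters s_l, l > k, of copy b;
  -- they are ascents.
  positions-Greedy : ∀ rk b Lo → FactorAscents rk → StartsAt Lo b rk →
    Greedy Lo (applyFactors rk idₙ) (positions b rk)
  positions-Greedy []       b Lo _                   _               = []
  positions-Greedy (k ∷ rk) b Lo (ascents , ascents-rk) (lo , skipped) =
    segment-Greedy b 0 k (applyFactors (k ∷ rk) idₙ) Lo (positions (suc b) rk) lo skipped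
      (subst (λ u → Greedy ((b , k) <ₚ_) u (positions (suc b) rk)) (sym (actWord-actDown k (applyFactors rk idₙ)))
        (positions-Greedy rk (suc b) ((b , k) <ₚ_) ascents-rk (next rk ascents)))
    where
    next : ∀ rk → Ascents k (applyFactors rk idₙ) → StartsAt ((b , k) <ₚ_) (suc b) rk
    next []        _       = tt
    next (k' ∷ rk) ascents = inj₁ (ℕ.n<1+n b) , skipped'
      where
      skipped' : SkippedAscents ((b , k) <ₚ_) (applyFactors (k' ∷ rk) idₙ) (suc b , 0)
      skipped' q q<n after before = ascents (proj₂ q) (proj₂ (<ₚ-between-copies q after before))
        (subst (proj₂ q <_) (sym (length-applyFactors (k' ∷ rk))) q<n)

  StartsAt-origin : ∀ rk → StartsAt (λ _ → ⊤) 0 rk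
  StartsAt-origin []       = tt
  StartsAt-origin (k ∷ rk) = tt , λ { (c , l) _ _ (inj₁ ()) ; (c , l) _ _ (inj₂ (_ , ())) }

sortingWord-applyFactors : ∀ n w rk → Admissible n 0 rk → rightPart w n ≡ applyFactors rk (rightPart idW n) →
  Σ (Word n) λ W → IsSortingWord n w W × (map toℕ W ≡ concatMap sDown (reverse rk))
sortingWord-applyFactors n w rk adm w≡ =
  let P , P≡ , sorting = greedy⇒IsSortingWord n w Pₙ (linked-positions 0 rk) letters< greedy evalPₙ ℓw
  in  spell P , sorting , trans (spell-toPosℕ P) (trans (cong spellℕ P≡) (spellℕ-positions 0 rk))
  where
  open Sorting n
  Pₙ = positions 0 rk
  letters< : All (λ q → proj₂ q < n) Pₙ
  letters< = letters<-positions n 0 rk (Admissible⇒All< n 0 rk adm)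
  evalPₙ : actWord idₙ (spellℕ Pₙ) ≡ rightPart w n
  evalPₙ = trans (cong (actWord idₙ) (spellℕ-positions 0 rk)) (trans (sym (applyFactors-actWord rk idₙ)) (sym w≡))
  ℓw : ℓ (rightPart w n) ≡ length Pₙ + ℓ idₙ
  ℓw = trans (cong ℓ w≡) (trans (proj₁ (proj₂ (applyFactors-NegAsc rk adm)))
         (cong (_+ ℓ idₙ) (sym (length-positions 0 rk))))
  greedy : Greedy (λ _ → ⊤) (rightPart w n) Pₙ
  greedy = subst (λ u → Greedy (λ _ → ⊤) u Pₙ) (sym w≡)
             (positions-Greedy rk 0 (λ _ → ⊤) (proj₂ (proj₂ (applyFactors-NegAsc rk adm))) (StartsAt-origin rk))

lemma20 : (n : ℕ) (w : Window) (i₁ : ℕ) (rest : List ℕ) →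
    All (λ i → 1 ≤ i) rest → i₁ + sumL rest ≡ n →
    map w (map suc (upTo n)) ≡ targetWindow i₁ rest →
    Σ (Word n) λ W → IsSortingWord n w W × (map toℕ W ≡ claimedWord n rest)
lemma20 .(i₁ + sumL rest) w i₁ rest _ refl w≡target =
  let W , sorting , letters = sortingWord-applyFactors n w rk admissible window
  in  W , sorting , trans letters (sym (claimedWord-factorIndices n rest))
  where
  n = i₁ + sumL rest
  rk = factorIndices n rest
  admissible : Admissible n 0 rk
  admissible = Admissible-factorIndices n rest (ℕ.m≤n+m (sumL rest) i₁)
  window : rightPart w n ≡ applyFactors rk (rightPart idW n)
  window = begin
    rightPart w n                       ≡⟨ List.map-applyUpTo suc w n ⟨
    map w (applyUpTo suc n)             ≡⟨ cong (map w) (List.map-upTo suc n) ⟨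
    map w (map suc (upTo n))            ≡⟨ w≡target ⟩
    targetWindow i₁ rest                ≡⟨ applyFactors-target i₁ rest ⟨
    applyFactors rk (rightPart idW n)   ∎
    where open ≡-Reasoning
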